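{- For every $n\ge 1$, the $\{\mathbf{3},\mathbf{2}+\mathbf{2}\}$-free naturally labelled posets on $[n]$ are in bijection with words of length $n$ over the alphabet $\{0,1\}$ whose letters carry distinct labels from $\{1,\dots,n\}$ (each label used exactly once), satisfying: (1) the first letter is $0$; (2) the labels on any two adjacent $0$s are in decreasing order (left to right); (3) the labels on any two adjacent $1$s are in increasing order; (4) the label on any $1$ is greater than the labels on all $0$s occurring earlier in the word.
   Context: A partial order $\preceq$ on $[n]$ is naturally labelled if $x\prec y$ implies $x<y$. It is $\mathbf{3}$-free if it has no chain $x\prec y\prec z$, and $(\mathbf{2}+\mathbf{2})$-free if it has no induced subposet isomorphic to the disjoint union of two 2-element chains. -}

module Defs where

open import Level using (0ℓ)
open import Data.Nat using (ℕ; zero; suc)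
open import Data.Bool using (Bool; true; false)
open import Data.Fin using (Fin; toℕ; inject₁) renaming (zero to fzero; suc to fsuc; _<_ to _<ᶠ_)
open import Data.Product using (Σ; _×_; _,_; proj₁; proj₂)
open import Data.Empty using (⊥)
open import Relation.Nullary using (¬_)
open import Relation.Binary.PropositionalEquality using (_≡_; _≢_; refl; sym; trans)
open import Relation.Binary.Bundles using (Setoid)
open import Relation.Binary.Structures using (IsEquivalence)
open import Function.Definitions using (Injective; Surjective)

-- Posets on [n] = Fin n (element i ∈ Fin n stands for i+1 ∈ {1..n}).
-- The order is given by a (decidable) Boolean relation: le x y ≡ true
-- means x ⪯ y.

Rel₂ : ℕ → Set
Rel₂ n = Fin n → Fin n → Bool

module _ {n : ℕ} (le : Rel₂ n) where

  _⪯_ : Fin n → Fin n → Set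
  x ⪯ y = le x y ≡ true

  _≺_ : Fin n → Fin n → Set
  x ≺ y = x ⪯ y × x ≢ y

  _∥_ : Fin n → Fin n → Set
  x ∥ y = ¬ (x ⪯ y) × ¬ (y ⪯ x)

  record IsPartialOrder : Set where
    field
      reflexive     : ∀ x → x ⪯ x
      antisymmetric : ∀ x y → x ⪯ y → y ⪯ x → x ≡ y
      transitive    : ∀ x y z → x ⪯ y → y ⪯ z → x ⪯ z

  NaturallyLabelled : Set
  NaturallyLabelled = ∀ x y → x ≺ y → x <ᶠ y

  ThreeFree : Set
  ThreeFree = ∀ x y z → x ≺ y → y ≺ z → ⊥

  TwoPlusTwoFree : Set
  TwoPlusTwoFree = ∀ a b c d → a ≺ b → c ≺ d →
    a ∥ c → a ∥ d → b ∥ c → b ∥ d → ⊥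

record GoodPoset (n : ℕ) : Set where
  field
    le         : Rel₂ n
    isPO       : IsPartialOrder le
    natural    : NaturallyLabelled le
    threeFree  : ThreeFree le
    twoTwoFree : TwoPlusTwoFree le

GoodPosetSetoid : ℕ → Setoid 0ℓ 0ℓ
GoodPosetSetoid n = record
  { Carrier = GoodPoset n
  ; _≈_ = λ P Q → ∀ x y → GoodPoset.le P x y ≡ GoodPoset.le Q x y
  ; isEquivalence = record
    { refl = λ x y → refl
    ; sym = λ p x y → sym (p x y)
    ; trans = λ p q x y → trans (p x y) (q x y)
    }
  }

-- Labelled words of length n: position i ∈ Fin n carries a letter
-- (false = 0, true = 1) and a label in Fin n (label j stands for j+1);
-- the labelling is a bijection positions → labels.

record GoodWord (n : ℕ) : Set where
  field
    letter      : Fin n → Bool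
    label       : Fin n → Fin n
    labelInj    : Injective _≡_ _≡_ label
    labelSurj   : Surjective _≡_ _≡_ label
    firstZero   : ∀ (i : Fin n) → toℕ i ≡ 0 → letter i ≡ false
    adjZeros    : ∀ (i j : Fin n) → suc (toℕ i) ≡ toℕ j →
                  letter i ≡ false → letter j ≡ false → label j <ᶠ label i
    adjOnes     : ∀ (i j : Fin n) → suc (toℕ i) ≡ toℕ j →
                  letter i ≡ true → letter j ≡ true → label i <ᶠ label j
    oneAbove    : ∀ (i j : Fin n) → i <ᶠ j →
                  letter i ≡ false → letter j ≡ true → label i <ᶠ label j

GoodWordSetoid : ℕ → Setoid 0ℓ 0ℓ
GoodWordSetoid n = record
  { Carrier = GoodWord n
  ; _≈_ = λ v w → ∀ i → (GoodWord.letter v i ≡ GoodWord.letter w i)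
                        × (GoodWord.label v i ≡ GoodWord.label w i)
  ; isEquivalence = record
    { refl = λ i → refl , refl
    ; sym = λ p i → sym (proj₁ (p i)) , sym (proj₂ (p i))
    ; trans = λ p q i → trans (proj₁ (p i)) (proj₁ (q i)) , trans (proj₂ (p i)) (proj₂ (q i))
    }
  }

{-# OPTIONS --safe #-}

-- In a 3-free poset every element is either minimal (a bottom, letter 0) or lies above some
-- element (a top, letter 1). The shadow of a top is its strict down-set; the shadow of a bottom is
-- the set of elements lying below every top above it. Two crossing shadows would produce an induced
-- 2+2, so the shadows form a chain under inclusion. Listing the elements by increasing shadow size,
-- ties broken by putting bottoms first, bottoms by decreasing and tops by increasing label, yields a
-- word satisfying (1)-(4), and x ≺ y holds exactly when x is a 0 written before the 1 y. Conversely,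
-- in the poset read off a word the shadows grow from left to right, and a tie between two equal
-- letters is decided by the run of equal letters joining them, so this listing returns the word.

module Submission where

open import Level using (0ℓ)
open import Defs hiding (_⪯_; _≺_)
open import Data.Bool using (Bool; true; false)
import Data.Bool.Properties as Boolₚ
open import Data.Empty using (⊥; ⊥-elim)
open import Data.Fin using (Fin; toℕ; fromℕ<; punchOut; inject₁; fromℕ; _<_; _≟_)
  renaming (suc to fsuc)
open import Data.Fin.Induction using (<-weakInduction; >-weakInduction)
import Data.Fin.Properties as Finₚ
open import Data.Fin.Subset using (Subset; ∣_∣) renaming (_∈_ to _∈ˢ_)
open import Data.Fin.Subset.Properties using (p⊆q⇒∣p∣≤∣q∣; p⊂q⇒∣p∣<∣q∣; ∈⊤; ∣⊤∣≡n)
open import Data.Integer as ℤ using (ℤ; +_; -[1+_])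
import Data.Integer.Properties as ℤₚ
open import Data.Nat as ℕ using (ℕ; zero; suc; z≤n; _≤_)
import Data.Nat.Properties as ℕₚ
open import Data.Product.Relation.Binary.Lex.Strict using (×-Lex; ×-isStrictTotalOrder)
open import Data.Product.Relation.Binary.Pointwise.NonDependent using (≡×≡⇒≡)
open import Data.Product using (_×_; _,_; proj₁; proj₂; ∃-syntax)
open import Data.Sum using (_⊎_; inj₁; inj₂; [_,_]′)
open import Data.Vec using (tabulate)
open import Data.Vec.Properties using (lookup⇒[]=; []=⇒lookup; lookup∘tabulate)
open import Function using (_∘_; const; _on_; case_of_)
open import Function.Bundles using (Bijection)
open import Function.Definitions using (Injective)
import Relation.Binary.Construct.On as On
open import Relation.Binary
  using (Rel; Setoid; IsStrictTotalOrder; Tri; tri<; tri≈; tri>; Transitive)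
open import Relation.Binary.PropositionalEquality
  using (_≡_; _≢_; refl; sym; trans; cong; subst; subst₂; resp₂; isEquivalence; module ≡-Reasoning)
open import Relation.Nullary using (¬_; Dec; yes; no; does)
open import Relation.Nullary.Decidable
  using (dec-true; dec-false; decidable-stable; _→-dec_; _×-dec_; _⊎-dec_; ¬?)
open import Relation.Unary using (Pred; Decidable; _⊆_; _∈_; _∉_)

does-true⇒ : ∀ {a} {A : Set a} (a? : Dec A) → does a? ≡ true → A
does-true⇒ (yes a) _ = a

≡-does : ∀ {a} {A : Set a} {b} (a? : Dec A) → (b ≡ true → A) → (A → b ≡ true) → b ≡ does a?
≡-does {b = true}  a? to _    = sym (dec-true a? (to refl))
≡-does {b = false} a? _  from = sym (dec-false a? (λ a → case from a of λ ()))

module _ {n ℓ} {P : Pred (Fin n) ℓ} (P? : Decidable P) where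

  subset : Subset n
  subset = tabulate (does ∘ P?)

  ∈-subset⁺ : ∀ {x} → P x → x ∈ˢ subset
  ∈-subset⁺ {x} px = lookup⇒[]= x subset (trans (lookup∘tabulate _ x) (dec-true (P? x) px))

  ∈-subset⁻ : ∀ {x} → x ∈ˢ subset → P x
  ∈-subset⁻ {x} x∈ = does-true⇒ (P? x) (trans (sym (lookup∘tabulate _ x)) ([]=⇒lookup x∈))

⊈⇒∃∖ : ∀ {n p q} {P : Pred (Fin n) p} {Q : Pred (Fin n) q} → Decidable P → Decidable Q →
        ¬ (P ⊆ Q) → ∃[ x ] P x × ¬ Q x
⊈⇒∃∖ P? Q? P⊈Q with Finₚ.¬∀⟶∃¬ _ _ (λ x → P? x →-dec Q? x) (λ P⇒Q → P⊈Q (P⇒Q _))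
... | x , ¬[Px⇒Qx] = x , decidable-stable (P? x) (λ ¬Px → ¬[Px⇒Qx] (⊥-elim ∘ ¬Px)) , ¬[Px⇒Qx] ∘ const

count : ∀ {n ℓ} {P : Pred (Fin n) ℓ} → Decidable P → ℕ
count P? = ∣ subset P? ∣

module _ {n ℓ₁ ℓ₂} {P : Pred (Fin n) ℓ₁} {Q : Pred (Fin n) ℓ₂}
         (P? : Decidable P) (Q? : Decidable Q) where

  count-mono : P ⊆ Q → count P? ≤ count Q?
  count-mono P⊆Q = p⊆q⇒∣p∣≤∣q∣ (∈-subset⁺ Q? ∘ P⊆Q ∘ ∈-subset⁻ P?)

  count-strictMono : P ⊆ Q → ∀ {x} → Q x → ¬ P x → count P? ℕ.< count Q?
  count-strictMono P⊆Q qx ¬px =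
    p⊂q⇒∣p∣<∣q∣ ((∈-subset⁺ Q? ∘ P⊆Q ∘ ∈-subset⁻ P?) , _ , ∈-subset⁺ Q? qx , ¬px ∘ ∈-subset⁻ P?)

count<n : ∀ {n ℓ} {P : Pred (Fin n) ℓ} (P? : Decidable P) {x} → ¬ P x → count P? ℕ.< n
count<n {n} P? ¬px = subst (count P? ℕ.<_) (∣⊤∣≡n n)
  (p⊂q⇒∣p∣<∣q∣ ((λ _ → ∈⊤) , _ , ∈⊤ , ¬px ∘ ∈-subset⁻ P?))

-- Ranking a strict total order on Fin n

injective⇒surjective : ∀ {n} {f : Fin n → Fin n} → Injective _≡_ _≡_ f → ∀ y → ∃[ x ] f x ≡ y
injective⇒surjective {suc m} {f} f-inj y with Finₚ.any? (λ x → f x ≟ y)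
... | yes found = found
... | no missed = ⊥-elim (ℕₚ.1+n≰n (Finₚ.injective⇒≤ g-inj))
  where
  f≢y : ∀ x → f x ≢ y
  f≢y x fx≡y = missed (x , fx≡y)

  g : Fin (suc m) → Fin m
  g x = punchOut (f≢y x ∘ sym)

  g-inj : Injective _≡_ _≡_ g
  g-inj {x} {x′} = f-inj ∘ Finₚ.punchOut-injective (f≢y x ∘ sym) (f≢y x′ ∘ sym)

StrictlyIncreasing : ∀ {n} → (Fin n → Fin n) → Set
StrictlyIncreasing f = ∀ {i j} → i < j → f i < f j

strictlyIncreasing⇒≗id : ∀ {n} {f : Fin n → Fin n} → StrictlyIncreasing f → ∀ i → f i ≡ i
strictlyIncreasing⇒≗id {suc m} {f} f-inc i =
  Finₚ.toℕ-injective (ℕₚ.≤-antisym (below i) (above i))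
  where
  step : ∀ j → f (inject₁ j) < f (fsuc j)
  step j = f-inc (subst (ℕ._< suc (toℕ j)) (sym (Finₚ.toℕ-inject₁ j)) ℕₚ.≤-refl)

  above : ∀ i → toℕ i ≤ toℕ (f i)
  above = <-weakInduction (λ i → toℕ i ≤ toℕ (f i)) z≤n λ j i≤fi →
    ℕₚ.≤-<-trans (subst (_≤ toℕ (f (inject₁ j))) (Finₚ.toℕ-inject₁ j) i≤fi) (step j)

  below : ∀ i → toℕ (f i) ≤ toℕ i
  below = >-weakInduction (λ i → toℕ (f i) ≤ toℕ i) (Finₚ.≤fromℕ (f (fromℕ m))) λ j fi≤i →
    subst (toℕ (f (inject₁ j)) ≤_) (sym (Finₚ.toℕ-inject₁ j)) (ℕ.s≤s⁻¹ (ℕₚ.<-≤-trans (step j) fi≤i))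

module Rank {n} {_⊏_ : Rel (Fin n) 0ℓ} (⊏-isStrictTotalOrder : IsStrictTotalOrder _≡_ _⊏_) where
  open IsStrictTotalOrder ⊏-isStrictTotalOrder using (irrefl; compare)
    renaming (trans to ⊏-trans; _<?_ to _⊏?_)

  opaque
    rank : Fin n → Fin n
    rank e = fromℕ< (count<n (_⊏? e) (irrefl refl))

    toℕ-rank : ∀ e → toℕ (rank e) ≡ count (_⊏? e)
    toℕ-rank e = Finₚ.toℕ-fromℕ< _

  rank-strictMono : ∀ {a b} → a ⊏ b → rank a < rank b
  rank-strictMono {a} {b} a⊏b = subst₂ ℕ._<_ (sym (toℕ-rank a)) (sym (toℕ-rank b))
    (count-strictMono (_⊏? a) (_⊏? b) (λ c⊏a → ⊏-trans c⊏a a⊏b) a⊏b (irrefl refl))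

  rank-reflects : ∀ {a b} → rank a < rank b → a ⊏ b
  rank-reflects {a} {b} ra<rb with compare a b
  ... | tri< a⊏b _ _ = a⊏b
  ... | tri≈ _ refl _ = ⊥-elim (ℕₚ.<-irrefl refl ra<rb)
  ... | tri> _ _ b⊏a = ⊥-elim (ℕₚ.<-asym ra<rb (rank-strictMono b⊏a))

  rank-injective : Injective _≡_ _≡_ rank
  rank-injective {a} {b} ra≡rb with compare a b
  ... | tri< a⊏b _ _ = ⊥-elim (ℕₚ.<-irrefl (cong toℕ ra≡rb) (rank-strictMono a⊏b))
  ... | tri≈ _ a≡b _ = a≡b
  ... | tri> _ _ b⊏a = ⊥-elim (ℕₚ.<-irrefl (cong toℕ (sym ra≡rb)) (rank-strictMono b⊏a))

  opaque
    unrank : Fin n → Fin n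
    unrank p = proj₁ (injective⇒surjective rank-injective p)

    rank-unrank : ∀ p → rank (unrank p) ≡ p
    rank-unrank p = proj₂ (injective⇒surjective rank-injective p)

  unrank-rank : ∀ e → unrank (rank e) ≡ e
  unrank-rank e = rank-injective (rank-unrank (rank e))

  unrank-strictMono : ∀ {i j} → i < j → unrank i ⊏ unrank j
  unrank-strictMono {i} {j} i<j =
    rank-reflects (subst₂ _<_ (sym (rank-unrank i)) (sym (rank-unrank j)) i<j)

  unrank-injective : Injective _≡_ _≡_ unrank
  unrank-injective {i} {j} eq = trans (sym (rank-unrank i)) (trans (cong rank eq) (rank-unrank j))

  consecutive⇒¬between : ∀ {i j b} → suc (toℕ i) ≡ toℕ j → unrank i ⊏ b → b ⊏ unrank j → ⊥
  consecutive⇒¬between {i} {j} {b} i→j i⊏b b⊏j = ℕₚ.<⇒≱ b<j (subst (_≤ toℕ (rank b)) i→j i<b)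
    where
    i<b : i < rank b
    i<b = subst (_< rank b) (rank-unrank i) (rank-strictMono i⊏b)
    b<j : rank b < j
    b<j = subst (rank b <_) (rank-unrank j) (rank-strictMono b⊏j)

  first⇒minimal : ∀ {i b} → toℕ i ≡ 0 → ¬ b ⊏ unrank i
  first⇒minimal {i} i≡0 b⊏i =
    ℕₚ.n≮0 (subst (toℕ (rank _) ℕ.<_) (trans (cong toℕ (rank-unrank i)) i≡0) (rank-strictMono b⊏i))

  rank-unique : (h : Fin n → Fin n) → (∀ {a b} → a ⊏ b → h a < h b) → ∀ e → rank e ≡ h e
  rank-unique h h-strictMono e = begin
    rank e                 ≡⟨ strictlyIncreasing⇒≗id (h-strictMono ∘ unrank-strictMono) (rank e) ⟨
    h (unrank (rank e))    ≡⟨ cong h (unrank-rank e) ⟩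
    h e                    ∎
    where open ≡-Reasoning

isStrictTotalOrder-≡ : ∀ {a ℓ₁ ℓ₂} {A : Set a} {_≈_ : Rel A ℓ₁} {_<_ : Rel A ℓ₂} →
                       IsStrictTotalOrder _≈_ _<_ → (∀ {x y} → x ≈ y → x ≡ y) →
                       IsStrictTotalOrder _≡_ _<_
isStrictTotalOrder-≡ {_<_ = _<_} sto ≈⇒≡ = record
  { isStrictPartialOrder = record
    { isEquivalence = isEquivalence
    ; irrefl        = λ { refl → S.irrefl S.Eq.refl }
    ; trans         = S.trans
    ; <-resp-≈      = resp₂ _<_
    }
  ; compare = compare
  }
  where
  module S = IsStrictTotalOrder sto

  compare : ∀ x y → Tri (x < y) (x ≡ y) (y < x)
  compare x y with S.compare x y
  ... | tri< x<y x≉y y≮x = tri< x<y (x≉y ∘ S.Eq.reflexive) y≮x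
  ... | tri≈ x≮y x≈y y≮x = tri≈ x≮y (≈⇒≡ x≈y) y≮x
  ... | tri> x≮y x≉y y<x = tri> x≮y (x≉y ∘ S.Eq.reflexive) y<x

-- The word of a poset

module Poset {n} (P : GoodPoset n) where
  open GoodPoset P

  infix 4 _⪯_ _≺_ _≺?_

  _⪯_ : Rel (Fin n) 0ℓ
  x ⪯ y = le x y ≡ true

  _≺_ : Rel (Fin n) 0ℓ
  x ≺ y = x ⪯ y × x ≢ y

  _≺?_ : ∀ x y → Dec (x ≺ y)
  x ≺? y = (le x y Boolₚ.≟ true) ×-dec ¬? (x ≟ y)

  ⪯⇒≡⊎≺ : ∀ {x y} → x ⪯ y → x ≡ y ⊎ x ≺ y
  ⪯⇒≡⊎≺ {x} {y} x⪯y with x ≟ y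
  ... | yes x≡y = inj₁ x≡y
  ... | no x≢y  = inj₂ (x⪯y , x≢y)

  ⪯-≺-collapse : ∀ {x y z} → x ⪯ y → y ≺ z → x ≡ y
  ⪯-≺-collapse {x} {y} {z} x⪯y y≺z with ⪯⇒≡⊎≺ x⪯y
  ... | inj₁ x≡y = x≡y
  ... | inj₂ x≺y = ⊥-elim (threeFree x y z x≺y y≺z)

  ≺-⪯-collapse : ∀ {x y z} → x ≺ y → y ⪯ z → y ≡ z
  ≺-⪯-collapse {x} {y} {z} x≺y y⪯z with ⪯⇒≡⊎≺ y⪯z
  ... | inj₁ y≡z = y≡z
  ... | inj₂ y≺z = ⊥-elim (threeFree x y z x≺y y≺z)

  crossing-incomparable : ∀ {z y w y′} → z ≺ y → w ≺ y′ → ¬ z ≺ y′ → ¬ w ≺ y →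
                          ¬ z ⪯ w × ¬ z ⪯ y′ × ¬ y′ ⪯ z × ¬ y ⪯ y′
  crossing-incomparable {z} {y} {w} {y′} z≺y w≺y′ z⊀y′ w⊀y =
    z⋠w , z⋠y′ , y′⋠z , y⋠y′
    where
    z⋠w : ¬ z ⪯ w
    z⋠w z⪯w with refl ← ⪯-≺-collapse z⪯w w≺y′ = z⊀y′ w≺y′
    z⋠y′ : ¬ z ⪯ y′
    z⋠y′ z⪯y′ with ⪯⇒≡⊎≺ z⪯y′
    ... | inj₁ refl = threeFree w z y w≺y′ z≺y
    ... | inj₂ z≺y′ = z⊀y′ z≺y′
    y′⋠z : ¬ y′ ⪯ z
    y′⋠z y′⪯z with refl ← ⪯-≺-collapse y′⪯z z≺y = threeFree w z y w≺y′ z≺y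
    y⋠y′ : ¬ y ⪯ y′
    y⋠y′ y⪯y′ with refl ← ≺-⪯-collapse z≺y y⪯y′ = z⊀y′ z≺y

  no-crossing : ∀ {z y w y′} → z ≺ y → w ≺ y′ → ¬ z ≺ y′ → ¬ w ≺ y → ⊥
  no-crossing z≺y w≺y′ z⊀y′ w⊀y
    with z⋠w , z⋠y′ , y′⋠z , y⋠y′ ← crossing-incomparable z≺y w≺y′ z⊀y′ w⊀y
       | w⋠z , w⋠y , y⋠w , y′⋠y ← crossing-incomparable w≺y′ z≺y w⊀y z⊀y′
    = twoTwoFree _ _ _ _ z≺y w≺y′ (z⋠w , w⋠z) (z⋠y′ , y′⋠z) (y⋠w , w⋠y) (y⋠y′ , y′⋠y)

  isTop : Fin n → Bool
  isTop e = does (Finₚ.any? (_≺? e))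

  isTop⁺ : ∀ {z e} → z ≺ e → isTop e ≡ true
  isTop⁺ z≺e = dec-true (Finₚ.any? (_≺? _)) (_ , z≺e)

  isTop⁻ : ∀ {e} → isTop e ≡ true → ∃[ z ] z ≺ e
  isTop⁻ = does-true⇒ (Finₚ.any? (_≺? _))

  ≺⇒isBottom : ∀ {x y} → x ≺ y → isTop x ≡ false
  ≺⇒isBottom {x} {y} x≺y = dec-false (Finₚ.any? (_≺? x)) λ (w , w≺x) → threeFree w x y w≺x x≺y

  ShadowOf : Bool → Fin n → Pred (Fin n) 0ℓ
  ShadowOf true  e z = z ≺ e
  ShadowOf false e z = ∀ y → e ≺ y → z ≺ y

  Shadow : Fin n → Pred (Fin n) 0ℓ
  Shadow e = ShadowOf (isTop e) e

  shadow? : ∀ e → Decidable (Shadow e)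
  shadow? e = shadowOf? (isTop e)
    where
    shadowOf? : ∀ b → Decidable (ShadowOf b e)
    shadowOf? true  z = z ≺? e
    shadowOf? false z = Finₚ.all? (λ y → e ≺? y →-dec z ≺? y)

  shadow-top⁻ : ∀ {e z} → isTop e ≡ true → z ∈ Shadow e → z ≺ e
  shadow-top⁻ t z∈ rewrite t = z∈

  shadow-top⁺ : ∀ {e z} → isTop e ≡ true → z ≺ e → z ∈ Shadow e
  shadow-top⁺ t z≺e rewrite t = z≺e

  shadow-bottom⁻ : ∀ {e z} → isTop e ≡ false → z ∈ Shadow e → ∀ y → e ≺ y → z ≺ y
  shadow-bottom⁻ b z∈ rewrite b = z∈

  shadow-bottom⁺ : ∀ {e z} → isTop e ≡ false → (∀ y → e ≺ y → z ≺ y) → z ∈ Shadow e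
  shadow-bottom⁺ b z∈ rewrite b = z∈

  bottom∈shadow : ∀ {e} → isTop e ≡ false → e ∈ Shadow e
  bottom∈shadow b = shadow-bottom⁺ b λ _ e≺y → e≺y

  ≺⇒shadow⊆ : ∀ {x y} → x ≺ y → Shadow x ⊆ Shadow y
  ≺⇒shadow⊆ x≺y z∈ = shadow-top⁺ (isTop⁺ x≺y) (shadow-bottom⁻ (≺⇒isBottom x≺y) z∈ _ x≺y)

  shadow-separates : ∀ {e z w} → z ∈ Shadow e → w ∉ Shadow e → ∃[ y ] z ≺ y × ¬ w ≺ y
  shadow-separates {e} z∈ w∉ with isTop e
  ... | true  = e , z∈ , w∉
  ... | false with y , e≺y , w⊀y ← ⊈⇒∃∖ (e ≺?_) (_ ≺?_) (λ ⊆ → w∉ (λ _ → ⊆)) = y , z∈ y e≺y , w⊀y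

  shadows-nested : ∀ {e f z w} → z ∈ Shadow e → z ∉ Shadow f → w ∈ Shadow f → w ∉ Shadow e → ⊥
  shadows-nested z∈e z∉f w∈f w∉e
    with y , z≺y , w⊀y ← shadow-separates z∈e w∉e
       | y′ , w≺y′ , z⊀y′ ← shadow-separates w∈f z∉f
    = no-crossing z≺y w≺y′ z⊀y′ w⊀y

  opaque
    size : Fin n → ℕ
    size e = count (shadow? e)

    separated⇒size< : ∀ {e f z} → z ∈ Shadow f → z ∉ Shadow e → size e ℕ.< size f
    separated⇒size< {e} {f} z∈f z∉e = count-strictMono (shadow? e) (shadow? f) e⊆f z∈f z∉e
      where
      e⊆f : Shadow e ⊆ Shadow f
      e⊆f {w} w∈e with shadow? f w
      ... | yes w∈f = w∈f
      ... | no  w∉f = ⊥-elim (shadows-nested w∈e w∉f z∈f z∉e)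

    size≤⇒shadow⊆ : ∀ {e f} → size e ≤ size f → Shadow e ⊆ Shadow f
    size≤⇒shadow⊆ {e} {f} e≤f {w} w∈e with shadow? f w
    ... | yes w∈f = w∈f
    ... | no  w∉f = ⊥-elim (ℕₚ.<⇒≱ (separated⇒size< w∈e w∉f) e≤f)

    size<⇒separated : ∀ {e f} → size e ℕ.< size f → ∃[ z ] z ∈ Shadow f × z ∉ Shadow e
    size<⇒separated {e} {f} e<f =
      ⊈⇒∃∖ (shadow? f) (shadow? e) (ℕₚ.<⇒≱ e<f ∘ count-mono (shadow? f) (shadow? e))

    size-mono : ∀ {e f} → Shadow e ⊆ Shadow f → size e ≤ size f
    size-mono {e} {f} = count-mono (shadow? e) (shadow? f)

  -- Bottoms are sent to negative integers, so they come first, and in decreasing label order.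
  signedLabel : Bool → Fin n → ℤ
  signedLabel true  e = + toℕ e
  signedLabel false e = -[1+ toℕ e ]

  signedLabel-injective : ∀ {a b e f} → signedLabel a e ≡ signedLabel b f → e ≡ f
  signedLabel-injective {true}  {true}  eq = Finₚ.toℕ-injective (ℤₚ.+-injective eq)
  signedLabel-injective {false} {false} eq = Finₚ.toℕ-injective (ℤₚ.-[1+-injective eq)
  signedLabel-injective {true}  {false} ()
  signedLabel-injective {false} {true}  ()

  key : Fin n → ℕ × ℤ
  key e = size e , signedLabel (isTop e) e

  infix 4 _⊏_
  _⊏_ : Rel (Fin n) 0ℓ
  _⊏_ = ×-Lex _≡_ ℕ._<_ ℤ._<_ on key

  ⊏-isStrictTotalOrder : IsStrictTotalOrder _≡_ _⊏_
  ⊏-isStrictTotalOrder = isStrictTotalOrder-≡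
    (On.isStrictTotalOrder key (×-isStrictTotalOrder ℕₚ.<-isStrictTotalOrder ℤₚ.<-isStrictTotalOrder))
    (signedLabel-injective ∘ cong proj₂ ∘ ≡×≡⇒≡)

  open Rank ⊏-isStrictTotalOrder public

  ≺⇒⊏ : ∀ {x y} → x ≺ y → x ⊏ y
  ≺⇒⊏ {x} {y} x≺y with ℕₚ.m≤n⇒m<n∨m≡n (size-mono (≺⇒shadow⊆ x≺y))
  ... | inj₁ x<y = inj₁ x<y
  ... | inj₂ x≡y = inj₂ (x≡y , tie)
    where
    tie : signedLabel (isTop x) x ℤ.< signedLabel (isTop y) y
    tie rewrite ≺⇒isBottom x≺y | isTop⁺ x≺y = ℤ.-<+

  ⊏⇒size≤ : ∀ {x y} → x ⊏ y → size x ≤ size y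
  ⊏⇒size≤ (inj₁ x<y)       = ℕₚ.<⇒≤ x<y
  ⊏⇒size≤ (inj₂ (x≡y , _)) = ℕₚ.≤-reflexive x≡y

  separated⇒⊏ : ∀ {e f z} → z ∈ Shadow f → z ∉ Shadow e → e ⊏ f
  separated⇒⊏ z∈f z∉e = inj₁ (separated⇒size< z∈f z∉e)

  bottom⊏top⇒≺ : ∀ {x y} → isTop x ≡ false → isTop y ≡ true → x ⊏ y → x ≺ y
  bottom⊏top⇒≺ bx ty x⊏y = shadow-top⁻ ty (size≤⇒shadow⊆ (⊏⇒size≤ x⊏y) (bottom∈shadow bx))

  bottoms-tie : ∀ {e f} → isTop e ≡ false → isTop f ≡ false →
                signedLabel (isTop e) e ℤ.< signedLabel (isTop f) f → f < e
  bottoms-tie be bf e<f rewrite be | bf = ℤₚ.drop‿-<- e<f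

  tops-tie : ∀ {e f} → isTop e ≡ true → isTop f ≡ true →
             signedLabel (isTop e) e ℤ.< signedLabel (isTop f) f → e < f
  tops-tie te tf e<f rewrite te | tf = ℤₚ.drop‿+<+ e<f

  first-isBottom : ∀ {i} → toℕ i ≡ 0 → isTop (unrank i) ≡ false
  first-isBottom i≡0 = Boolₚ.¬-not λ top →
    let z , z≺i = isTop⁻ top in first⇒minimal i≡0 (≺⇒⊏ z≺i)

  consecutive-bottoms : ∀ {i j} → suc (toℕ i) ≡ toℕ j →
                        isTop (unrank i) ≡ false → isTop (unrank j) ≡ false → unrank j < unrank i
  consecutive-bottoms i→j bi bj with unrank-strictMono (ℕₚ.≤-reflexive i→j)
  ... | inj₂ (_ , tie) = bottoms-tie bi bj tie
  ... | inj₁ i<j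
    with z , z∈j , z∉i ← size<⇒separated i<j
    with y , i≺y , z⊀y ← shadow-separates (bottom∈shadow bi) z∉i
    = ⊥-elim (consecutive⇒¬between i→j (≺⇒⊏ i≺y) (separated⇒⊏ z∈j (z⊀y ∘ shadow-top⁻ (isTop⁺ i≺y))))

  consecutive-tops : ∀ {i j} → suc (toℕ i) ≡ toℕ j →
                     isTop (unrank i) ≡ true → isTop (unrank j) ≡ true → unrank i < unrank j
  consecutive-tops i→j ti tj with unrank-strictMono (ℕₚ.≤-reflexive i→j)
  ... | inj₂ (_ , tie) = tops-tie ti tj tie
  ... | inj₁ i<j with z , z∈j , z∉i ← size<⇒separated i<j =
    ⊥-elim (consecutive⇒¬between i→j (separated⇒⊏ (bottom∈shadow (≺⇒isBottom z≺j)) z∉i) (≺⇒⊏ z≺j))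
    where
    z≺j = shadow-top⁻ tj z∈j

  word : GoodWord n
  word = record
    { letter    = isTop ∘ unrank
    ; label     = unrank
    ; labelInj  = unrank-injective
    ; labelSurj = λ e → rank e , λ i≡ → trans (cong unrank i≡) (unrank-rank e)
    ; firstZero = λ _ → first-isBottom
    ; adjZeros  = λ _ _ → consecutive-bottoms
    ; adjOnes   = λ _ _ → consecutive-tops
    ; oneAbove  = λ _ _ i<j bi tj → natural _ _ (bottom⊏top⇒≺ bi tj (unrank-strictMono i<j))
    }

-- The poset of a word

module _ {n a ℓ q} {A : Set a} {_R_ : Rel A ℓ} (R-trans : Transitive _R_)
         {Q : Pred (Fin n) q} (Q? : Decidable Q) (f : Fin n → A)
         (adjacent : ∀ i j → suc (toℕ i) ≡ toℕ j → Q i → Q j → f i R f j) where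

  gap-or-chain : ∀ {p q} → p < q → Q p → Q q → (∃[ r ] p < r × r < q × ¬ Q r) ⊎ f p R f q
  gap-or-chain {p} {q} p<q = go (toℕ q ℕ.∸ suc (toℕ p)) (sym (ℕₚ.m∸n+n≡m p<q))
    where
    go : ∀ k {q} → toℕ q ≡ k ℕ.+ suc (toℕ p) → Q p → Q q →
         (∃[ r ] p < r × r < q × ¬ Q r) ⊎ f p R f q
    go zero    q≡ Qp Qq = inj₂ (adjacent _ _ (sym q≡) Qp Qq)
    go (suc k) {q} q≡ Qp Qq = extend (Q? q′)
      where
      m<n : k ℕ.+ suc (toℕ p) ℕ.< n
      m<n = ℕₚ.<-trans (ℕₚ.n<1+n _) (subst (ℕ._< n) q≡ (Finₚ.toℕ<n q))

      q′ : Fin n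
      q′ = fromℕ< m<n

      q′≡ : toℕ q′ ≡ k ℕ.+ suc (toℕ p)
      q′≡ = Finₚ.toℕ-fromℕ< m<n

      p<q′ : p < q′
      p<q′ = subst (toℕ p ℕ.<_) (sym q′≡) (ℕₚ.m≤n+m (suc (toℕ p)) k)

      q′<q : q′ < q
      q′<q = subst₂ ℕ._<_ (sym q′≡) (sym q≡) (ℕₚ.n<1+n _)

      extend : Dec (Q q′) → (∃[ r ] p < r × r < q × ¬ Q r) ⊎ f p R f q
      extend (no ¬Qq′) = inj₁ (q′ , p<q′ , q′<q , ¬Qq′)
      extend (yes Qq′) with go k q′≡ Qp Qq′
      ... | inj₁ (r , p<r , r<q′ , ¬Qr) = inj₁ (r , p<r , Finₚ.<-trans r<q′ q′<q , ¬Qr)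
      ... | inj₂ fpRfq′ = inj₂ (R-trans fpRfq′ (adjacent q′ q (trans (cong suc q′≡) (sym q≡)) Qq′ Qq))

module Word {n} (w : GoodWord n) where
  open GoodWord w

  pos : Fin n → Fin n
  pos x = proj₁ (labelSurj x)

  label-pos : ∀ x → label (pos x) ≡ x
  label-pos x = proj₂ (labelSurj x) refl

  pos-label : ∀ i → pos (label i) ≡ i
  pos-label i = labelInj (label-pos (label i))

  pos-injective : Injective _≡_ _≡_ pos
  pos-injective {x} {y} eq = trans (sym (label-pos x)) (trans (cong label eq) (label-pos y))

  infix 4 _◁_ _◁?_
  _◁_ : Rel (Fin n) 0ℓ
  x ◁ y = letter (pos x) ≡ false × letter (pos y) ≡ true × pos x < pos y

  _◁?_ : ∀ x y → Dec (x ◁ y)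
  x ◁? y = letter (pos x) Boolₚ.≟ false ×-dec letter (pos y) Boolₚ.≟ true ×-dec pos x Finₚ.<? pos y

  ◁-irrefl : ∀ {x} → ¬ x ◁ x
  ◁-irrefl (_ , _ , x<x) = Finₚ.<-irrefl refl x<x

  ◁-chainFree : ∀ {x y z} → x ◁ y → ¬ y ◁ z
  ◁-chainFree (_ , top , _) (bottom , _ , _) with () ← trans (sym top) bottom

  ◁-label : ∀ {x r} → letter (pos x) ≡ false → letter r ≡ true → pos x < r → x ◁ label r
  ◁-label {r = r} x₀ r₁ x<r rewrite pos-label r = x₀ , r₁ , x<r

  label-◁ : ∀ {r y} → letter r ≡ false → letter (pos y) ≡ true → r < pos y → label r ◁ y
  label-◁ {r} r₀ y₁ r<y rewrite pos-label r = r₀ , y₁ , r<y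

  first◁top : ∀ {y} → letter (pos y) ≡ true → ∃[ x ] x ◁ y
  first◁top {y} y₁ = label i₀ , label-◁ (firstZero i₀ i₀≡0) y₁ i₀<y
    where
    y≢0 : toℕ (pos y) ≢ 0
    y≢0 y≡0 with () ← trans (sym y₁) (firstZero (pos y) y≡0)

    0<y : 0 ℕ.< toℕ (pos y)
    0<y = ℕₚ.n≢0⇒n>0 y≢0

    i₀ : Fin n
    i₀ = fromℕ< (ℕₚ.<-trans 0<y (Finₚ.toℕ<n (pos y)))

    i₀≡0 : toℕ i₀ ≡ 0
    i₀≡0 = Finₚ.toℕ-fromℕ< _

    i₀<y : i₀ < pos y
    i₀<y = subst (ℕ._< toℕ (pos y)) (sym i₀≡0) 0<y

  order : Rel₂ n
  order x y = does (x ≟ y ⊎-dec x ◁? y)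

  order-reflexive : ∀ {x y} → x ≡ y → order x y ≡ true
  order-reflexive {x} {y} x≡y = dec-true (x ≟ y ⊎-dec x ◁? y) (inj₁ x≡y)

  ◁⇒order : ∀ {x y} → x ◁ y → order x y ≡ true
  ◁⇒order {x} {y} x◁y = dec-true (x ≟ y ⊎-dec x ◁? y) (inj₂ x◁y)

  order⇒≡⊎◁ : ∀ {x y} → order x y ≡ true → x ≡ y ⊎ x ◁ y
  order⇒≡⊎◁ {x} {y} = does-true⇒ (x ≟ y ⊎-dec x ◁? y)

  order⇒◁ : ∀ {x y} → order x y ≡ true → x ≢ y → x ◁ y
  order⇒◁ x≤y x≢y with order⇒≡⊎◁ x≤y
  ... | inj₁ x≡y = ⊥-elim (x≢y x≡y)
  ... | inj₂ x◁y = x◁y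

  order-isPartialOrder : IsPartialOrder order
  order-isPartialOrder = record
    { reflexive     = λ _ → order-reflexive refl
    ; antisymmetric = λ _ _ x≤y y≤x → antisym (order⇒≡⊎◁ x≤y) (order⇒≡⊎◁ y≤x)
    ; transitive    = λ _ _ _ x≤y y≤z → trans′ (order⇒≡⊎◁ x≤y) (order⇒≡⊎◁ y≤z)
    }
    where
    antisym : ∀ {x y} → x ≡ y ⊎ x ◁ y → y ≡ x ⊎ y ◁ x → x ≡ y
    antisym (inj₁ x≡y) _          = x≡y
    antisym (inj₂ _)   (inj₁ y≡x) = sym y≡x
    antisym (inj₂ x◁y) (inj₂ y◁x) = ⊥-elim (◁-chainFree x◁y y◁x)

    trans′ : ∀ {x y z} → x ≡ y ⊎ x ◁ y → y ≡ z ⊎ y ◁ z → order x z ≡ true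
    trans′ (inj₁ refl) y≤z        = [ order-reflexive , ◁⇒order ]′ y≤z
    trans′ (inj₂ x◁y)  (inj₁ refl) = ◁⇒order x◁y
    trans′ (inj₂ x◁y)  (inj₂ y◁z)  = ⊥-elim (◁-chainFree x◁y y◁z)

  order-twoPlusTwoFree : TwoPlusTwoFree order
  order-twoPlusTwoFree a b c d (a≤b , a≢b) (c≤d , c≢d) (a⋠c , _) (a⋠d , _) (_ , c⋠b) _
    with order⇒◁ a≤b a≢b | order⇒◁ c≤d c≢d | Finₚ.<-cmp (pos a) (pos c)
  ... | a₀ , _ , _    | _ , d₁ , c<d | tri< a<c _ _ = a⋠d (◁⇒order (a₀ , d₁ , Finₚ.<-trans a<c c<d))
  ... | _ | _ | tri≈ _ a≡c _ = a⋠c (order-reflexive (pos-injective a≡c))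
  ... | _ , b₁ , a<b | c₀ , _ , _    | tri> _ _ c<a = c⋠b (◁⇒order (c₀ , b₁ , Finₚ.<-trans c<a a<b))

  poset : GoodPoset n
  poset = record
    { le         = order
    ; isPO       = order-isPartialOrder
    ; natural    = λ x y (x≤y , x≢y) → natural (order⇒◁ x≤y x≢y)
    ; threeFree  = λ x y z (x≤y , x≢y) (y≤z , y≢z) → ◁-chainFree (order⇒◁ x≤y x≢y) (order⇒◁ y≤z y≢z)
    ; twoTwoFree = order-twoPlusTwoFree
    }
    where
    natural : ∀ {x y} → x ◁ y → x < y
    natural {x} {y} (x₀ , y₁ , x<y) = subst₂ _<_ (label-pos x) (label-pos y) (oneAbove _ _ x<y x₀ y₁)

-- The two constructions are mutually inverse

module WordOfPoset {n} (P : GoodPoset n) where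
  open GoodPoset P using (le; isPO)
  open Poset P
  private module W = Word word

  pos≡rank : ∀ x → W.pos x ≡ rank x
  pos≡rank x = unrank-injective (trans (W.label-pos x) (sym (unrank-rank x)))

  letter-pos≡isTop : ∀ x → GoodWord.letter word (W.pos x) ≡ isTop x
  letter-pos≡isTop x = cong isTop (W.label-pos x)

  ◁⇒≺ : ∀ {x y} → x W.◁ y → x ≺ y
  ◁⇒≺ {x} {y} (x₀ , y₁ , x<y) = bottom⊏top⇒≺
    (trans (sym (letter-pos≡isTop x)) x₀) (trans (sym (letter-pos≡isTop y)) y₁)
    (rank-reflects (subst₂ _<_ (pos≡rank x) (pos≡rank y) x<y))

  ≺⇒◁ : ∀ {x y} → x ≺ y → x W.◁ y
  ≺⇒◁ {x} {y} x≺y = trans (letter-pos≡isTop x) (≺⇒isBottom x≺y)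
                   , trans (letter-pos≡isTop y) (isTop⁺ x≺y)
                   , subst₂ _<_ (sym (pos≡rank x)) (sym (pos≡rank y)) (rank-strictMono (≺⇒⊏ x≺y))

  le≗order-word : ∀ x y → le x y ≡ W.order x y
  le≗order-word x y = ≡-does (x ≟ y ⊎-dec x W.◁? y) to from
    where
    to : x ⪯ y → x ≡ y ⊎ x W.◁ y
    to x⪯y with ⪯⇒≡⊎≺ x⪯y
    ... | inj₁ x≡y = inj₁ x≡y
    ... | inj₂ x≺y = inj₂ (≺⇒◁ x≺y)

    from : x ≡ y ⊎ x W.◁ y → x ⪯ y
    from (inj₁ refl) = IsPartialOrder.reflexive isPO x
    from (inj₂ x◁y)  = proj₁ (◁⇒≺ x◁y)

module Uniqueness {n} (P : GoodPoset n) (w : GoodWord n)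
                  (le≗order : ∀ x y → GoodPoset.le P x y ≡ Word.order w x y) where
  open Poset P
  open Word w
  open GoodWord w using (letter; label; adjZeros; adjOnes)
  open IsStrictTotalOrder ⊏-isStrictTotalOrder using () renaming (irrefl to ⊏-irrefl; asym to ⊏-asym)

  ≺⇒◁ : ∀ {x y} → x ≺ y → x ◁ y
  ≺⇒◁ {x} {y} (x⪯y , x≢y) = order⇒◁ (trans (sym (le≗order x y)) x⪯y) x≢y

  ◁⇒≺ : ∀ {x y} → x ◁ y → x ≺ y
  ◁⇒≺ {x} {y} x◁y = trans (le≗order x y) (◁⇒order x◁y) , λ { refl → ◁-irrefl x◁y }

  isTop≡letter : ∀ e → isTop e ≡ letter (pos e)
  isTop≡letter e with letter (pos e) in e-letter
  ... | true  = let x , x◁e = first◁top e-letter in isTop⁺ (◁⇒≺ x◁e)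
  ... | false = Boolₚ.¬-not λ top →
    let z , z≺e = isTop⁻ top ; _ , e₁ , _ = ≺⇒◁ z≺e in case trans (sym e₁) e-letter of λ ()

  isTop-letter : ∀ {e b} → letter (pos e) ≡ b → isTop e ≡ b
  isTop-letter {e} = trans (isTop≡letter e)

  letter-isTop : ∀ {e b} → isTop e ≡ b → letter (pos e) ≡ b
  letter-isTop {e} = trans (sym (isTop≡letter e))

  shadow-mono : ∀ {e f} → pos e < pos f → Shadow e ⊆ Shadow f
  shadow-mono {e} {f} e<f {z} z∈e with isTop e in te | isTop f in tf
  ... | false | false = λ y f≺y → let _ , y₁ , f<y = ≺⇒◁ f≺y in
                          z∈e y (◁⇒≺ (letter-isTop te , y₁ , Finₚ.<-trans e<f f<y))
  ... | false | true  = z∈e f (◁⇒≺ (letter-isTop te , letter-isTop tf , e<f))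
  ... | true  | false = λ y f≺y → let z₀ , _ , z<e = ≺⇒◁ z∈e ; _ , y₁ , f<y = ≺⇒◁ f≺y in
                          ◁⇒≺ (z₀ , y₁ , Finₚ.<-trans z<e (Finₚ.<-trans e<f f<y))
  ... | true  | true  = let z₀ , _ , z<e = ≺⇒◁ z∈e in
                          ◁⇒≺ (z₀ , letter-isTop tf , Finₚ.<-trans z<e e<f)

  bottoms-ordered : ∀ {e f} → pos e < pos f → letter (pos e) ≡ false → letter (pos f) ≡ false →
                    Shadow f ⊆ Shadow e → f < e
  bottoms-ordered {e} {f} e<f e₀ f₀ f⊆e
    with gap-or-chain {_R_ = λ x y → y < x} (λ x>y y>z → Finₚ.<-trans y>z x>y)
                      (λ i → letter i Boolₚ.≟ false) label adjZeros e<f e₀ f₀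
  ... | inj₂ f<e = subst₂ _<_ (label-pos f) (label-pos e) f<e
  ... | inj₁ (r , e<r , r<f , r₁) = ⊥-elim (f∉e (f⊆e (bottom∈shadow (isTop-letter f₀))))
    where
    e◁r : e ◁ label r
    e◁r = ◁-label e₀ (Boolₚ.¬-not r₁) e<r

    f∉e : f ∉ Shadow e
    f∉e f∈e = let _ , _ , f<r = ≺⇒◁ (shadow-bottom⁻ (isTop-letter e₀) f∈e _ (◁⇒≺ e◁r)) in
              Finₚ.<-asym r<f (subst (pos f <_) (pos-label r) f<r)

  tops-ordered : ∀ {e f} → pos e < pos f → letter (pos e) ≡ true → letter (pos f) ≡ true →
                 Shadow f ⊆ Shadow e → e < f
  tops-ordered {e} {f} e<f e₁ f₁ f⊆e
    with gap-or-chain {_R_ = _<_} Finₚ.<-trans (λ i → letter i Boolₚ.≟ true) label adjOnes e<f e₁ f₁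
  ... | inj₂ e<f′ = subst₂ _<_ (label-pos e) (label-pos f) e<f′
  ... | inj₁ (r , e<r , r<f , r₀) = ⊥-elim (r∉e (f⊆e r∈f))
    where
    r◁f : label r ◁ f
    r◁f = label-◁ (Boolₚ.¬-not r₀) f₁ r<f

    r∈f : label r ∈ Shadow f
    r∈f = shadow-top⁺ (isTop-letter f₁) (◁⇒≺ r◁f)

    r∉e : label r ∉ Shadow e
    r∉e r∈e = let _ , _ , r<e = ≺⇒◁ (shadow-top⁻ (isTop-letter e₁) r∈e) in
              Finₚ.<-asym e<r (subst (_< pos e) (pos-label r) r<e)

  tie-break : ∀ {e f} → pos e < pos f → Shadow f ⊆ Shadow e →
              signedLabel (letter (pos e)) e ℤ.< signedLabel (letter (pos f)) f
  tie-break {e} {f} e<f f⊆e with letter (pos e) in e-letter | letter (pos f) in f-letter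
  ... | false | true  = ℤ.-<+
  ... | false | false = ℤ.-<- (bottoms-ordered e<f e-letter f-letter f⊆e)
  ... | true  | true  = ℤ.+<+ (tops-ordered e<f e-letter f-letter f⊆e)
  ... | true  | false = ⊥-elim (f∉e (f⊆e (bottom∈shadow (isTop-letter f-letter))))
    where
    f∉e : f ∉ Shadow e
    f∉e f∈e = let _ , _ , f<e = ≺⇒◁ (shadow-top⁻ (isTop-letter e-letter) f∈e) in Finₚ.<-asym e<f f<e

  pos<⇒⊏ : ∀ {e f} → pos e < pos f → e ⊏ f
  pos<⇒⊏ {e} {f} e<f with ℕₚ.m≤n⇒m<n∨m≡n (size-mono (shadow-mono e<f))
  ... | inj₁ size< = inj₁ size<
  ... | inj₂ size≡ = inj₂ (size≡ , subst₂ (λ a b → signedLabel a e ℤ.< signedLabel b f)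
                                         (sym (isTop≡letter e)) (sym (isTop≡letter f))
                                         (tie-break e<f (size≤⇒shadow⊆ (ℕₚ.≤-reflexive (sym size≡)))))

  ⊏⇒pos< : ∀ {e f} → e ⊏ f → pos e < pos f
  ⊏⇒pos< {e} {f} e⊏f with Finₚ.<-cmp (pos e) (pos f)
  ... | tri< e<f _ _ = e<f
  ... | tri≈ _ e≡f _ = ⊥-elim (⊏-irrefl (pos-injective e≡f) e⊏f)
  ... | tri> _ _ f<e = ⊥-elim (⊏-asym e⊏f (pos<⇒⊏ f<e))

  unrank≡label : ∀ i → unrank i ≡ label i
  unrank≡label i = begin
    unrank i                  ≡⟨ cong unrank (pos-label i) ⟨
    unrank (pos (label i))    ≡⟨ cong unrank (rank-unique pos ⊏⇒pos< (label i)) ⟨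
    unrank (rank (label i))   ≡⟨ unrank-rank (label i) ⟩
    label i                   ∎
    where open ≡-Reasoning

  word≈ : ∀ i → GoodWord.letter word i ≡ letter i × GoodWord.label word i ≡ label i
  word≈ i = letter≡ , unrank≡label i
    where
    open ≡-Reasoning
    letter≡ : isTop (unrank i) ≡ letter i
    letter≡ = begin
      isTop (unrank i)          ≡⟨ cong isTop (unrank≡label i) ⟩
      isTop (label i)           ≡⟨ isTop≡letter (label i) ⟩
      letter (pos (label i))    ≡⟨ cong letter (pos-label i) ⟩
      letter i                  ∎

_≈ʷ_ : ∀ {n} → GoodWord n → GoodWord n → Set
_≈ʷ_ {n} = Setoid._≈_ (GoodWordSetoid n)

pos-cong : ∀ {n} (v w : GoodWord n) → v ≈ʷ w → ∀ x → Word.pos v x ≡ Word.pos w x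
pos-cong v w v≈w x = GoodWord.labelInj w (begin
  GoodWord.label w (V.pos x)   ≡⟨ proj₂ (v≈w (V.pos x)) ⟨
  GoodWord.label v (V.pos x)   ≡⟨ V.label-pos x ⟩
  x                            ≡⟨ W.label-pos x ⟨
  GoodWord.label w (W.pos x)   ∎)
  where
  open ≡-Reasoning
  module V = Word v
  module W = Word w

order-cong : ∀ {n} (v w : GoodWord n) → v ≈ʷ w → ∀ x y → Word.order v x y ≡ Word.order w x y
order-cong v w v≈w x y
  rewrite pos-cong v w v≈w x | pos-cong v w v≈w y
        | proj₁ (v≈w (Word.pos w x)) | proj₁ (v≈w (Word.pos w y)) = refl

proposition3p2 : (n : ℕ) → 1 ≤ n → Bijection (GoodPosetSetoid n) (GoodWordSetoid n)
proposition3p2 n _ = record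
  { to        = Poset.word
  ; cong      = λ {P} {Q} P≈Q → Uniqueness.word≈ P (Poset.word Q) λ x y →
                  trans (P≈Q x y) (WordOfPoset.le≗order-word Q x y)
  ; bijective = (λ {P} {Q} wP≈wQ x y → begin
                  GoodPoset.le P x y              ≡⟨ WordOfPoset.le≗order-word P x y ⟩
                  Word.order (Poset.word P) x y   ≡⟨ order-cong (Poset.word P) (Poset.word Q) wP≈wQ x y ⟩
                  Word.order (Poset.word Q) x y   ≡⟨ WordOfPoset.le≗order-word Q x y ⟨
                  GoodPoset.le Q x y              ∎)
              , λ w → Word.poset w , λ {P} P≈w → Uniqueness.word≈ P w P≈w
  }
  where open ≡-Reasoning
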